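{- Let $D$ be a controllable oriented graph of order $n$, and let $C$ be an oriented graph having the same generalized skew spectrum as $D$. If $Q$ is a rational orthogonal matrix with $Q^TS(D)Q=S(C)$ and $Qe=e$, then $W(C)$ is nonsingular and $Q=W(D)\,W(C)^{ -1}$.
   Context: An oriented graph on vertices $v_1,\dots,v_n$ is a digraph obtained from a simple undirected graph by orienting each edge. Its skew-adjacency matrix $S(D)=(s_{ij})$ has $s_{ij}=1$ if $(v_i,v_j)$ is an arc, $s_{ij}=-1$ if $(v_j,v_i)$ is an arc, and $0$ otherwise. Let $e$ be the all-ones vector of length $n$ and $J$ the all-ones $n\times n$ matrix. The skew-walk matrix is $W(D)=[e,S(D)e,\dots,S(D)^{n-1}e]$, and $D$ is controllable if $W(D)$ is nonsingular. $D$ and $C$ have the same generalized skew spectrum if $S(D),S(C)$ have the same eigenvalues (with multiplicity) and $J-S(D),J-S(C)$ have the same eigenvalues (with multiplicity). -}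

module Defs where

open import Data.Nat using (ℕ; zero; suc)
open import Data.Fin using (Fin; zero; suc; toℕ; punchIn)
open import Data.Bool using (Bool; true; false; T; not)
open import Data.List using (List; []; _∷_)
open import Data.Product using (_×_)
open import Data.Rational using (ℚ; 0ℚ; 1ℚ; _+_; _*_; -_)
open import Relation.Binary.PropositionalEquality using (_≡_)
open import Relation.Nullary using (¬_)

module GenericDet {R : Set} (z o : R) (add mul : R → R → R) (neg : R → R) where

  sumR : ∀ {n} → (Fin n → R) → R
  sumR {zero}  f = z
  sumR {suc n} f = add (f zero) (sumR (λ i → f (suc i)))

  sgn : ℕ → R → R
  sgn zero    x = x
  sgn (suc k) x = neg (sgn k x)

  det : ∀ {n} → (Fin n → Fin n → R) → R
  det {zero}  A = o
  det {suc n} A =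
    sumR (λ j → sgn (toℕ j) (mul (A zero j) (det (λ r c → A (suc r) (punchIn j c)))))

Matrix : ℕ → Set
Matrix n = Fin n → Fin n → ℚ

Vector : ℕ → Set
Vector n = Fin n → ℚ

open GenericDet 0ℚ 1ℚ _+_ _*_ -_ public using (sumR)

detℚ : ∀ {n} → Matrix n → ℚ
detℚ = GenericDet.det 0ℚ 1ℚ _+_ _*_ -_

δ : ∀ {n} → Fin n → Fin n → ℚ
δ zero    zero    = 1ℚ
δ zero    (suc j) = 0ℚ
δ (suc i) zero    = 0ℚ
δ (suc i) (suc j) = δ i j

I : ∀ {n} → Matrix n
I = δ

J : ∀ {n} → Matrix n
J _ _ = 1ℚ

e : ∀ {n} → Vector n
e _ = 1ℚ

_·_ : ∀ {n} → Matrix n → Matrix n → Matrix n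
(A · B) i j = sumR (λ k → A i k * B k j)

_⊙_ : ∀ {n} → Matrix n → Vector n → Vector n
(A ⊙ v) i = sumR (λ k → A i k * v k)

_ᵀ : ∀ {n} → Matrix n → Matrix n
(A ᵀ) i j = A j i

_−_ : ∀ {n} → Matrix n → Matrix n → Matrix n
(A − B) i j = A i j + (- B i j)

_≈_ : ∀ {n} → Matrix n → Matrix n → Set
A ≈ B = ∀ i j → A i j ≡ B i j

powVec : ∀ {n} → Matrix n → ℕ → Vector n → Vector n
powVec A zero    v = v
powVec A (suc k) v = A ⊙ powVec A k v

Nonsingular : ∀ {n} → Matrix n → Set
Nonsingular A = ¬ (detℚ A ≡ 0ℚ)

record OrientedGraph (n : ℕ) : Set where
  field
    arc        : Fin n → Fin n → Bool
    asymmetric : ∀ i j → T (arc i j) → T (not (arc j i))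
-- (asymmetry also forces looplessness: arc i i would imply ¬ arc i i)

open OrientedGraph public

skewEntry : Bool → Bool → ℚ
skewEntry true  _     = 1ℚ
skewEntry false true  = - 1ℚ
skewEntry false false = 0ℚ

S : ∀ {n} → OrientedGraph n → Matrix n
S D i j = skewEntry (arc D i j) (arc D j i)

W : ∀ {n} → OrientedGraph n → Matrix n
W D i k = powVec (S D) (toℕ k) e i

Controllable : ∀ {n} → OrientedGraph n → Set
Controllable D = Nonsingular (W D)

-- Polynomials over ℚ (ascending coefficient lists) and characteristic
-- polynomials.

Poly : Set
Poly = List ℚ

padd : Poly → Poly → Poly
padd []       q        = q
padd (a ∷ p)  []       = a ∷ p
padd (a ∷ p)  (b ∷ q)  = (a + b) ∷ padd p q

pscale : ℚ → Poly → Poly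
pscale c []      = []
pscale c (a ∷ p) = (c * a) ∷ pscale c p

pmul : Poly → Poly → Poly
pmul []      q = []
pmul (a ∷ p) q = padd (pscale a q) (0ℚ ∷ pmul p q)

pneg : Poly → Poly
pneg = pscale (- 1ℚ)

pconst : ℚ → Poly
pconst c = c ∷ []

coeff : Poly → ℕ → ℚ
coeff []      _       = 0ℚ
coeff (a ∷ p) zero    = a
coeff (a ∷ p) (suc k) = coeff p k

_≈ₚ_ : Poly → Poly → Set
p ≈ₚ q = ∀ k → coeff p k ≡ coeff q k

detₚ : ∀ {n} → (Fin n → Fin n → Poly) → Poly
detₚ = GenericDet.det [] (pconst 1ℚ) padd pmul pneg

-- characteristic polynomial det(x I - A)
charPoly : ∀ {n} → Matrix n → Poly
charPoly A = detₚ (λ i j → padd (pscale (δ i j) (0ℚ ∷ 1ℚ ∷ [])) (pconst (- A i j)))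

-- same eigenvalues with multiplicity (over ℂ) = same characteristic polynomial
SameSpectrum : ∀ {n} → Matrix n → Matrix n → Set
SameSpectrum A B = charPoly A ≈ₚ charPoly B

SameGenSkewSpectrum : ∀ {n} → OrientedGraph n → OrientedGraph n → Set
SameGenSkewSpectrum D C =
  SameSpectrum (S D) (S C) × SameSpectrum (J − S D) (J − S C)

Orthogonal : ∀ {n} → Matrix n → Set
Orthogonal Q = ((Q ᵀ) · Q) ≈ I

IsInverse : ∀ {n} → Matrix n → Matrix n → Set
IsInverse A M = ((A · M) ≈ I) × ((M · A) ≈ I)

{-# OPTIONS --safe #-}
-- From Qᵀ Q = I we get Q Qᵀ = I and Qᵀ e = Qᵀ Q e = e, hence S(C)ᵏ⁺¹ e = Qᵀ S(D) Q Qᵀ S(D)ᵏ e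
-- = Qᵀ S(D)ᵏ⁺¹ e by induction, i.e. W(C) = Qᵀ W(D). So M = W(D)⁻¹ Q satisfies W(D) M = Q and
-- W(C) M = Qᵀ Q = I. The linear algebra behind this (a nonzero determinant gives an inverse, a
-- one-sided inverse is two-sided) rests on the Laplace-expansion determinant being multilinear and
-- alternating in the rows: every such form satisfies f A = det A · f I (expand the first row, clear
-- the pivot column with it, and recurse on the minor), so det is multiplicative, and A · adj A = det A · I.
module Submission where

open import Defs
open import Data.Nat using (ℕ; zero; suc)
open import Data.Fin using (Fin; zero; suc; toℕ; punchIn; punchOut; inject₁)
import Data.Fin.Properties as Finₚ
open import Data.Fin.Induction using (<-weakInduction)
open import Data.Vec.Functional using (updateAt; insertAt; removeAt; _∷_; tail)
import Data.Vec.Functional.Properties as Vecₚ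
open import Data.Rational using (ℚ; 0ℚ; 1ℚ; ½; _+_; _*_; -_; 1/_; ≢-nonZero)
import Data.Rational.Properties as ℚₚ
open import Data.Rational.Solver using (module +-*-Solver)
open +-*-Solver using (solve; _:+_; _:*_; :-_; _:=_; con)
open import Data.Product using (Σ; _×_; _,_; proj₁; proj₂)
open import Function using (_∘_; const)
open import Relation.Binary.Bundles using (Setoid)
import Relation.Binary.Reasoning.Setoid as SetoidReasoning
open import Relation.Nullary using (yes; no; contradiction)
open import Relation.Binary.PropositionalEquality

open GenericDet 0ℚ 1ℚ _+_ _*_ -_ using (sgn)

sign : ℕ → ℚ
sign k = sgn k 1ℚ

sgn≡sign* : ∀ k x → sgn k x ≡ sign k * x
sgn≡sign* zero    x = sym (ℚₚ.*-identityˡ x)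
sgn≡sign* (suc k) x = trans (cong -_ (sgn≡sign* k x)) (ℚₚ.neg-distribˡ-* (sign k) x)

x≡-x⇒x≡0 : ∀ {x} → x ≡ - x → x ≡ 0ℚ
x≡-x⇒x≡0 {x} x≡-x = begin
  x                 ≡⟨ solve 1 (λ x → x := con ½ :* x :+ con ½ :* x) refl x ⟩
  ½ * x + ½ * x     ≡⟨ cong (λ y → ½ * x + ½ * y) x≡-x ⟩
  ½ * x + ½ * (- x) ≡⟨ solve 1 (λ x → con ½ :* x :+ con ½ :* (:- x) := con 0ℚ) refl x ⟩
  0ℚ                ∎
  where open ≡-Reasoning

*≡1⇒≢0ˡ : ∀ {x y} → x * y ≡ 1ℚ → x ≢ 0ℚ
*≡1⇒≢0ˡ {x} {y} xy≡1 refl with trans (sym xy≡1) (ℚₚ.*-zeroˡ y)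
... | ()

*≡1⇒≢0ʳ : ∀ {x y} → x * y ≡ 1ℚ → y ≢ 0ℚ
*≡1⇒≢0ʳ {x} {y} xy≡1 = *≡1⇒≢0ˡ (trans (ℚₚ.*-comm y x) xy≡1)

sumR-cong : ∀ {n} {f g : Fin n → ℚ} → f ≗ g → sumR f ≡ sumR g
sumR-cong {zero}  f≗g = refl
sumR-cong {suc n} f≗g = cong₂ _+_ (f≗g zero) (sumR-cong (f≗g ∘ suc))

sumR-lincomb : ∀ {n} {f : Fin n → ℚ} (g h : Fin n → ℚ) x → (∀ i → f i ≡ g i + x * h i) → sumR f ≡ sumR g + x * sumR h
sumR-lincomb {zero}  g h x eq = solve 1 (λ x → con 0ℚ := con 0ℚ :+ x :* con 0ℚ) refl x
sumR-lincomb {suc n} g h x eq = begin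
  _ ≡⟨ cong₂ _+_ (eq zero) (sumR-lincomb (g ∘ suc) (h ∘ suc) x (eq ∘ suc)) ⟩
  (g zero + x * h zero) + (G + x * H)
    ≡⟨ solve 5 (λ a b c d x → (a :+ x :* b) :+ (c :+ x :* d) := (a :+ c) :+ x :* (b :+ d)) refl (g zero) (h zero) G H x ⟩
  (g zero + G) + x * (h zero + H) ∎
  where
  open ≡-Reasoning
  G : ℚ
  G = sumR (g ∘ suc)
  H : ℚ
  H = sumR (h ∘ suc)

sumR-*ˡ : ∀ {n} x (f : Fin n → ℚ) → sumR (λ i → x * f i) ≡ x * sumR f
sumR-*ˡ {zero}  x f = sym (ℚₚ.*-zeroʳ x)
sumR-*ˡ {suc n} x f = trans (cong (x * f zero +_) (sumR-*ˡ x (f ∘ suc))) (sym (ℚₚ.*-distribˡ-+ x _ _))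

sumR-*ʳ : ∀ {n} x (f : Fin n → ℚ) → sumR (λ i → f i * x) ≡ sumR f * x
sumR-*ʳ x f = trans (sumR-cong (λ i → ℚₚ.*-comm (f i) x)) (trans (sumR-*ˡ x f) (ℚₚ.*-comm x _))

sumR-neg : ∀ {n} (f : Fin n → ℚ) → sumR (λ i → - f i) ≡ - sumR f
sumR-neg {zero}  f = refl
sumR-neg {suc n} f = trans (cong (- f zero +_) (sumR-neg (f ∘ suc))) (sym (ℚₚ.neg-distrib-+ (f zero) _))

sumR-+ : ∀ {n} (f g : Fin n → ℚ) → sumR (λ i → f i + g i) ≡ sumR f + sumR g
sumR-+ f g = trans (sumR-lincomb f g 1ℚ (λ i → cong (f i +_) (sym (ℚₚ.*-identityˡ (g i)))))
                   (cong (sumR f +_) (ℚₚ.*-identityˡ _))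

sumR-zero : ∀ n → sumR {n} (const 0ℚ) ≡ 0ℚ
sumR-zero zero    = refl
sumR-zero (suc n) = cong (0ℚ +_) (sumR-zero n)

sumR-comm : ∀ {m n} (f : Fin m → Fin n → ℚ) → sumR (λ i → sumR (f i)) ≡ sumR (λ j → sumR (λ i → f i j))
sumR-comm {zero}  {n} f = sym (sumR-zero n)
sumR-comm {suc m} f = trans (cong (sumR (f zero) +_) (sumR-comm (f ∘ suc))) (sym (sumR-+ (f zero) _))

sumR-punchIn : ∀ {n} (p : Fin (suc n)) (f : Fin (suc n) → ℚ) → sumR f ≡ f p + sumR (f ∘ punchIn p)
sumR-punchIn zero            f = refl
sumR-punchIn {suc n} (suc p) f = begin
  f zero + sumR (f ∘ suc)                          ≡⟨ cong (f zero +_) (sumR-punchIn p (f ∘ suc)) ⟩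
  f zero + (f (suc p) + sumR (f ∘ suc ∘ punchIn p)) ≡⟨ solve 3 (λ a b c → a :+ (b :+ c) := b :+ (a :+ c)) refl (f zero) (f (suc p)) _ ⟩
  f (suc p) + (f zero + sumR (f ∘ suc ∘ punchIn p)) ∎
  where open ≡-Reasoning

δ-refl : ∀ {n} (i : Fin n) → δ i i ≡ 1ℚ
δ-refl zero    = refl
δ-refl (suc i) = δ-refl i

δ-≢ : ∀ {n} {i j : Fin n} → i ≢ j → δ i j ≡ 0ℚ
δ-≢ {i = zero}  {zero}  i≢j = contradiction refl i≢j
δ-≢ {i = zero}  {suc j} i≢j = refl
δ-≢ {i = suc i} {zero}  i≢j = refl
δ-≢ {i = suc i} {suc j} i≢j = δ-≢ (i≢j ∘ cong suc)

δ-sym : ∀ {n} (i j : Fin n) → δ i j ≡ δ j i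
δ-sym zero    zero    = refl
δ-sym zero    (suc j) = refl
δ-sym (suc i) zero    = refl
δ-sym (suc i) (suc j) = δ-sym i j

sumR-δˡ : ∀ {n} (i : Fin n) (f : Fin n → ℚ) → sumR (λ k → δ i k * f k) ≡ f i
sumR-δˡ {suc n} zero    f = begin
  1ℚ * f zero + sumR (λ k → 0ℚ * f (suc k)) ≡⟨ cong (1ℚ * f zero +_) (sumR-cong (λ k → ℚₚ.*-zeroˡ (f (suc k)))) ⟩
  1ℚ * f zero + sumR {n} (const 0ℚ)         ≡⟨ cong (1ℚ * f zero +_) (sumR-zero n) ⟩
  1ℚ * f zero + 0ℚ                          ≡⟨ solve 1 (λ a → con 1ℚ :* a :+ con 0ℚ := a) refl (f zero) ⟩
  f zero                                    ∎
  where open ≡-Reasoning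
sumR-δˡ {suc n} (suc i) f = trans (cong (0ℚ * f zero +_) (sumR-δˡ i (f ∘ suc)))
                                  (solve 2 (λ a b → con 0ℚ :* a :+ b := b) refl (f zero) (f (suc i)))

sumR-δʳ : ∀ {n} (i : Fin n) (f : Fin n → ℚ) → sumR (λ k → f k * δ k i) ≡ f i
sumR-δʳ i f = trans (sumR-cong (λ k → trans (ℚₚ.*-comm (f k) _) (cong (_* f k) (δ-sym k i)))) (sumR-δˡ i f)

≈-refl : ∀ {n} {A : Matrix n} → A ≈ A
≈-refl i j = refl

≈-sym : ∀ {n} {A B : Matrix n} → A ≈ B → B ≈ A
≈-sym A≈B i j = sym (A≈B i j)

≈-trans : ∀ {n} {A B C : Matrix n} → A ≈ B → B ≈ C → A ≈ C
≈-trans A≈B B≈C i j = trans (A≈B i j) (B≈C i j)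

≈-setoid : ℕ → Setoid _ _
≈-setoid n = record
  { Carrier       = Matrix n
  ; _≈_           = _≈_
  ; isEquivalence = record { refl = ≈-refl ; sym = ≈-sym ; trans = ≈-trans }
  }

module ≈-Reasoning {n} = SetoidReasoning (≈-setoid n)
module ≗-Reasoning {n} = SetoidReasoning (Fin n →-setoid ℚ)

⊙-cong : ∀ {n} {A B : Matrix n} {u v : Vector n} → A ≈ B → u ≗ v → A ⊙ u ≗ B ⊙ v
⊙-cong A≈B u≗v i = sumR-cong (λ k → cong₂ _*_ (A≈B i k) (u≗v k))

⊙-congˡ : ∀ {n} (A : Matrix n) {u v : Vector n} → u ≗ v → A ⊙ u ≗ A ⊙ v
⊙-congˡ A = ⊙-cong (≈-refl {A = A})

·-cong : ∀ {n} {A A′ B B′ : Matrix n} → A ≈ A′ → B ≈ B′ → (A · B) ≈ (A′ · B′)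
·-cong A≈A′ B≈B′ i j = ⊙-cong A≈A′ (λ k → B≈B′ k j) i

·-congˡ : ∀ {n} (A : Matrix n) {B B′ : Matrix n} → B ≈ B′ → (A · B) ≈ (A · B′)
·-congˡ A B≈B′ = ·-cong (≈-refl {A = A}) B≈B′

·-congʳ : ∀ {n} (B : Matrix n) {A A′ : Matrix n} → A ≈ A′ → (A · B) ≈ (A′ · B)
·-congʳ B A≈A′ = ·-cong A≈A′ (≈-refl {A = B})

⊙-assoc : ∀ {n} (A B : Matrix n) (v : Vector n) → (A · B) ⊙ v ≗ A ⊙ (B ⊙ v)
⊙-assoc A B v i = begin
  sumR (λ k → sumR (λ l → A i l * B l k) * v k)   ≡⟨ sumR-cong (λ k → sym (sumR-*ʳ (v k) (λ l → A i l * B l k))) ⟩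
  sumR (λ k → sumR (λ l → A i l * B l k * v k))   ≡⟨ sumR-comm (λ k l → A i l * B l k * v k) ⟩
  sumR (λ l → sumR (λ k → A i l * B l k * v k))   ≡⟨ sumR-cong (λ l → trans (sumR-cong (λ k → ℚₚ.*-assoc (A i l) (B l k) (v k)))
                                                                           (sumR-*ˡ (A i l) (λ k → B l k * v k))) ⟩
  sumR (λ l → A i l * sumR (λ k → B l k * v k))   ∎
  where open ≡-Reasoning

·-assoc : ∀ {n} (A B C : Matrix n) → ((A · B) · C) ≈ (A · (B · C))
·-assoc A B C i j = ⊙-assoc A B (λ k → C k j) i

⊙-identityˡ : ∀ {n} (v : Vector n) → I ⊙ v ≗ v
⊙-identityˡ v i = sumR-δˡ i v

·-identityˡ : ∀ {n} (A : Matrix n) → (I · A) ≈ A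
·-identityˡ A i j = ⊙-identityˡ (λ k → A k j) i

·-identityʳ : ∀ {n} (A : Matrix n) → (A · I) ≈ A
·-identityʳ A i j = sumR-δʳ j (A i)

infixl 6 _[_]≔_

_[_]≔_ : ∀ {n} {X : Set} → (Fin n → X) → Fin n → X → Fin n → X
xs [ r ]≔ v = updateAt xs r (const v)

swapRows : ∀ {n} {X : Set} → (Fin n → X) → Fin n → Fin n → Fin n → X
swapRows xs p q = (xs [ p ]≔ xs q) [ q ]≔ xs p

[]≔-cong : ∀ {n} {X : Set} {xs ys : Fin n → X} r (v : X) → xs ≗ ys → (xs [ r ]≔ v) ≗ (ys [ r ]≔ v)
[]≔-cong zero    v eq zero    = refl
[]≔-cong zero    v eq (suc i) = eq (suc i)
[]≔-cong (suc r) v eq zero    = eq zero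
[]≔-cong (suc r) v eq (suc i) = []≔-cong r v (eq ∘ suc) i

map-[]≔ : ∀ {n} {X Y : Set} (g : X → Y) (xs : Fin n → X) r v → g ∘ (xs [ r ]≔ v) ≗ (g ∘ xs) [ r ]≔ g v
map-[]≔ g xs r v = Vecₚ.map-updateAt-local {f = g} xs r refl

map-swapRows : ∀ {n} {X Y : Set} (g : X → Y) (xs : Fin n → X) p q → g ∘ swapRows xs p q ≗ swapRows (g ∘ xs) p q
map-swapRows g xs p q i = trans (map-[]≔ g (xs [ p ]≔ xs q) q (xs p) i)
                                ([]≔-cong q (g (xs p)) (map-[]≔ g xs p (xs q)) i)

swapRows-comm : ∀ {n} {X : Set} (xs : Fin n → X) {p q} → p ≢ q → swapRows xs p q ≗ swapRows xs q p
swapRows-comm xs {p} {q} p≢q i with i Finₚ.≟ p | i Finₚ.≟ q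
... | yes refl | yes refl = contradiction refl p≢q
... | yes refl | no i≢q   = begin
  swapRows xs i q i  ≡⟨ Vecₚ.updateAt-minimal i q _ i≢q ⟩
  (xs [ i ]≔ xs q) i ≡⟨ Vecₚ.updateAt-updates i xs ⟩
  xs q               ≡⟨ Vecₚ.updateAt-updates i _ ⟨
  swapRows xs q i i  ∎
  where open ≡-Reasoning
... | no i≢p   | yes refl = begin
  swapRows xs p i i  ≡⟨ Vecₚ.updateAt-updates i _ ⟩
  xs p               ≡⟨ Vecₚ.updateAt-updates i xs ⟨
  (xs [ i ]≔ xs p) i ≡⟨ Vecₚ.updateAt-minimal i p _ i≢p ⟨
  swapRows xs i p i  ∎
  where open ≡-Reasoning
... | no i≢p   | no i≢q   = begin
  swapRows xs p q i  ≡⟨ Vecₚ.updateAt-minimal i q _ i≢q ⟩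
  (xs [ p ]≔ xs q) i ≡⟨ Vecₚ.updateAt-minimal i p xs i≢p ⟩
  xs i               ≡⟨ Vecₚ.updateAt-minimal i q xs i≢q ⟨
  (xs [ q ]≔ xs p) i ≡⟨ Vecₚ.updateAt-minimal i p _ i≢p ⟨
  swapRows xs q p i  ∎
  where open ≡-Reasoning

rows≡⇒≈ : ∀ {n} {A B : Matrix n} → A ≗ B → A ≈ B
rows≡⇒≈ A≗B i = cong-app (A≗B i)

[]≔-cong-≈ : ∀ {n} {A B : Matrix n} r {u v : Vector n} → A ≈ B → u ≗ v → (A [ r ]≔ u) ≈ (B [ r ]≔ v)
[]≔-cong-≈ {A = A} {B} r {u} {v} A≈B u≗v i c with i Finₚ.≟ r
... | yes refl = trans (cong-app (Vecₚ.updateAt-updates i A) c)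
                       (trans (u≗v c) (sym (cong-app (Vecₚ.updateAt-updates i B) c)))
... | no i≢r   = trans (cong-app (Vecₚ.updateAt-minimal i r A i≢r) c)
                       (trans (A≈B i c) (sym (cong-app (Vecₚ.updateAt-minimal i r B i≢r) c)))

swapRows-self : ∀ {n} (A : Matrix n) {p q} → A p ≗ A q → swapRows A p q ≈ A
swapRows-self A {p} {q} Ap≗Aq i c with i Finₚ.≟ q
... | yes refl = trans (cong-app (Vecₚ.updateAt-updates i _) c) (Ap≗Aq c)
... | no i≢q with i Finₚ.≟ p
...   | yes refl = trans (cong-app (Vecₚ.updateAt-minimal i q _ i≢q) c)
                         (trans (cong-app (Vecₚ.updateAt-updates i A) c) (sym (Ap≗Aq c)))
...   | no i≢p   = cong-app (trans (Vecₚ.updateAt-minimal i q _ i≢q) (Vecₚ.updateAt-minimal i p A i≢p)) c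

reset-invariant⇒constant : ∀ {n} {X Y : Set} (a : X) (φ : (Fin n → X) → Y) →
                           (∀ {s t} → s ≗ t → φ s ≡ φ t) → (∀ t r → φ (t [ r ]≔ a) ≡ φ t) →
                           ∀ t → φ t ≡ φ (const a)
reset-invariant⇒constant {zero}  a φ φ-cong reset t = φ-cong (λ ())
reset-invariant⇒constant {suc n} {X} {Y} a φ φ-cong reset t = begin
  φ t                 ≡⟨ reset t zero ⟨
  φ (t [ zero ]≔ a)   ≡⟨ φ-cong (λ { zero → refl ; (suc i) → refl }) ⟩
  ψ (tail t)          ≡⟨ reset-invariant⇒constant a ψ ψ-cong ψ-reset (tail t) ⟩
  ψ (const a)         ≡⟨ φ-cong (λ { zero → refl ; (suc i) → refl }) ⟩
  φ (const a)         ∎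
  where
  open ≡-Reasoning
  ψ : (Fin n → X) → Y
  ψ s = φ (a ∷ s)
  ψ-cong : ∀ {s t} → s ≗ t → ψ s ≡ ψ t
  ψ-cong s≗t = φ-cong (λ { zero → refl ; (suc i) → s≗t i })
  ψ-reset : ∀ s r → ψ (s [ r ]≔ a) ≡ ψ s
  ψ-reset s r = trans (φ-cong (λ { zero → refl ; (suc i) → refl })) (reset (a ∷ s) (suc r))

insertAt-cong : ∀ {n} {u v : Vector n} k a → u ≗ v → insertAt u k a ≗ insertAt v k a
insertAt-cong         zero    a u≗v zero    = refl
insertAt-cong         zero    a u≗v (suc c) = u≗v c
insertAt-cong {suc n} (suc k) a u≗v zero    = u≗v zero
insertAt-cong {suc n} (suc k) a u≗v (suc c) = insertAt-cong k a (u≗v ∘ suc) c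

insertAt-lincomb : ∀ {n} (u v : Vector n) x k c →
                   insertAt (λ i → u i + x * v i) k 0ℚ c ≡ insertAt u k 0ℚ c + x * insertAt v k 0ℚ c
insertAt-lincomb         u v x zero    zero    = solve 1 (λ x → con 0ℚ := con 0ℚ :+ x :* con 0ℚ) refl x
insertAt-lincomb         u v x zero    (suc c) = refl
insertAt-lincomb {suc n} u v x (suc k) zero    = refl
insertAt-lincomb {suc n} u v x (suc k) (suc c) = insertAt-lincomb (u ∘ suc) (v ∘ suc) x k c

insertAt-split : ∀ {n} (v : Vector n) k x c → insertAt v k x c ≡ insertAt v k 0ℚ c + x * δ k c
insertAt-split         v zero    x zero    = solve 1 (λ x → x := con 0ℚ :+ x :* con 1ℚ) refl x
insertAt-split         v zero    x (suc c) = solve 2 (λ a x → a := a :+ x :* con 0ℚ) refl (v c) x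
insertAt-split {suc n} v (suc k) x zero    = solve 2 (λ a x → a := a :+ x :* con 0ℚ) refl (v zero) x
insertAt-split {suc n} v (suc k) x (suc c) = insertAt-split (v ∘ suc) k x c

insertAt-zero : ∀ {n} (k : Fin (suc n)) → insertAt {n = n} (const 0ℚ) k 0ℚ ≗ const 0ℚ
insertAt-zero         zero    zero    = refl
insertAt-zero         zero    (suc c) = refl
insertAt-zero {suc n} (suc k) zero    = refl
insertAt-zero {suc n} (suc k) (suc c) = insertAt-zero k c

insertAt-δ : ∀ {n} (k : Fin (suc n)) (r : Fin n) → insertAt (δ r) k 0ℚ ≗ δ (punchIn k r)
insertAt-δ zero    r       zero    = refl
insertAt-δ zero    r       (suc c) = refl
insertAt-δ (suc k) zero    zero    = refl
insertAt-δ (suc k) zero    (suc c) = insertAt-zero k c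
insertAt-δ (suc k) (suc r) zero    = refl
insertAt-δ (suc k) (suc r) (suc c) = insertAt-δ k r c

minor : ∀ {n} → Matrix (suc n) → Fin (suc n) → Matrix n
minor A j r = removeAt (A (suc r)) j

cofactor : ∀ {n} → Matrix (suc n) → Fin (suc n) → ℚ
cofactor A j = sign (toℕ j) * detℚ (minor A j)

det-expand : ∀ {n} (A : Matrix (suc n)) → detℚ A ≡ sumR (λ j → A zero j * cofactor A j)
det-expand A = sumR-cong λ j → trans (sgn≡sign* (toℕ j) _)
  (solve 3 (λ s a d → s :* (a :* d) := a :* (s :* d)) refl (sign (toℕ j)) (A zero j) (detℚ (minor A j)))

det-cong : ∀ {n} {A B : Matrix n} → A ≈ B → detℚ A ≡ detℚ B
det-cong {zero}  A≈B = refl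
det-cong {suc n} A≈B = sumR-cong λ j →
  cong (sgn (toℕ j)) (cong₂ _*_ (A≈B zero j) (det-cong (λ r c → A≈B (suc r) (punchIn j c))))

minor-[]≔ : ∀ {n} (A : Matrix (suc n)) r w j → minor (A [ suc r ]≔ w) j ≈ (minor A j [ r ]≔ removeAt w j)
minor-[]≔ A r w j = rows≡⇒≈ (map-[]≔ (λ row → removeAt row j) (tail A) r w)

minor-swapRows : ∀ {n} (A : Matrix (suc n)) p q j → minor (swapRows A (suc p) (suc q)) j ≈ swapRows (minor A j) p q
minor-swapRows A p q j = rows≡⇒≈ (map-swapRows (λ row → removeAt row j) (tail A) p q)

RowLinear : ∀ {n} → (Matrix n → ℚ) → Set
RowLinear {n} f = ∀ A r (u v : Vector n) x → f (A [ r ]≔ (λ c → u c + x * v c)) ≡ f (A [ r ]≔ u) + x * f (A [ r ]≔ v)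

det-rowLinear : ∀ {n} → RowLinear (detℚ {n})
det-rowLinear {suc n} A zero u v x = begin
  detℚ (A [ zero ]≔ (λ c → u c + x * v c))
    ≡⟨ det-expand (A [ zero ]≔ (λ c → u c + x * v c)) ⟩
  sumR (λ j → (u j + x * v j) * cofactor A j)
    ≡⟨ sumR-lincomb (λ j → u j * cofactor A j) (λ j → v j * cofactor A j) x (λ j →
         solve 4 (λ a b x c → (a :+ x :* b) :* c := a :* c :+ x :* (b :* c)) refl (u j) (v j) x (cofactor A j)) ⟩
  sumR (λ j → u j * cofactor A j) + x * sumR (λ j → v j * cofactor A j)
    ≡⟨ cong₂ (λ a b → a + x * b) (det-expand (A [ zero ]≔ u)) (det-expand (A [ zero ]≔ v)) ⟨
  detℚ (A [ zero ]≔ u) + x * detℚ (A [ zero ]≔ v) ∎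
  where open ≡-Reasoning
det-rowLinear {suc n} A (suc r) u v x = begin
  detℚ (A [ suc r ]≔ (λ c → u c + x * v c))
    ≡⟨ det-expand (A [ suc r ]≔ (λ c → u c + x * v c)) ⟩
  sumR (λ j → A zero j * cofactor (A [ suc r ]≔ (λ c → u c + x * v c)) j)
    ≡⟨ sumR-lincomb (λ j → A zero j * cofactor (A [ suc r ]≔ u) j) (λ j → A zero j * cofactor (A [ suc r ]≔ v) j)
                    x linear-in-row ⟩
  sumR (λ j → A zero j * cofactor (A [ suc r ]≔ u) j) + x * sumR (λ j → A zero j * cofactor (A [ suc r ]≔ v) j)
    ≡⟨ cong₂ (λ a b → a + x * b) (det-expand (A [ suc r ]≔ u)) (det-expand (A [ suc r ]≔ v)) ⟨
  detℚ (A [ suc r ]≔ u) + x * detℚ (A [ suc r ]≔ v) ∎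
  where
  open ≡-Reasoning
  cofactor-[]≔ : ∀ w j → cofactor (A [ suc r ]≔ w) j ≡ sign (toℕ j) * detℚ (minor A j [ r ]≔ removeAt w j)
  cofactor-[]≔ w j = cong (sign (toℕ j) *_) (det-cong (minor-[]≔ A r w j))
  linear-in-row : ∀ j → A zero j * cofactor (A [ suc r ]≔ (λ c → u c + x * v c)) j
                      ≡ A zero j * cofactor (A [ suc r ]≔ u) j + x * (A zero j * cofactor (A [ suc r ]≔ v) j)
  linear-in-row j = begin
    A zero j * cofactor (A [ suc r ]≔ (λ c → u c + x * v c)) j
      ≡⟨ cong (A zero j *_) (cofactor-[]≔ _ j) ⟩
    A zero j * (s * detℚ (minor A j [ r ]≔ (λ c → removeAt u j c + x * removeAt v j c)))
      ≡⟨ cong (λ d → A zero j * (s * d)) (det-rowLinear (minor A j) r (removeAt u j) (removeAt v j) x) ⟩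
    A zero j * (s * (P + x * R))
      ≡⟨ solve 5 (λ a s p x r → a :* (s :* (p :+ x :* r)) := a :* (s :* p) :+ x :* (a :* (s :* r))) refl (A zero j) s P x R ⟩
    A zero j * (s * P) + x * (A zero j * (s * R))
      ≡⟨ cong₂ (λ c d → A zero j * c + x * (A zero j * d)) (cofactor-[]≔ u j) (cofactor-[]≔ v j) ⟨
    A zero j * cofactor (A [ suc r ]≔ u) j + x * (A zero j * cofactor (A [ suc r ]≔ v) j) ∎
    where
    s : ℚ
    s = sign (toℕ j)
    P : ℚ
    P = detℚ (minor A j [ r ]≔ removeAt u j)
    R : ℚ
    R = detℚ (minor A j [ r ]≔ removeAt v j)

punchIn-punchOut-comm : ∀ {m} {p q : Fin (suc (suc m))} (p≢q : p ≢ q) (q≢p : q ≢ p) c →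
                        punchIn p (punchIn (punchOut p≢q) c) ≡ punchIn q (punchIn (punchOut q≢p) c)
punchIn-punchOut-comm {p = zero}  {zero}  p≢q q≢p c = contradiction refl p≢q
punchIn-punchOut-comm {p = zero}  {suc q} p≢q q≢p c = refl
punchIn-punchOut-comm {p = suc p} {zero}  p≢q q≢p c = refl
punchIn-punchOut-comm {suc m} {suc p} {suc q} p≢q q≢p zero    = refl
punchIn-punchOut-comm {suc m} {suc p} {suc q} p≢q q≢p (suc c) =
  cong suc (punchIn-punchOut-comm (p≢q ∘ cong suc) (q≢p ∘ cong suc) c)

sign-punchOut-anti : ∀ {m} {p q : Fin (suc (suc m))} (p≢q : p ≢ q) (q≢p : q ≢ p) →
                     sign (toℕ q) * sign (toℕ (punchOut q≢p)) ≡ - (sign (toℕ p) * sign (toℕ (punchOut p≢q)))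
sign-punchOut-anti {p = zero}  {zero}  p≢q q≢p = contradiction refl p≢q
sign-punchOut-anti {p = zero}  {suc q} p≢q q≢p = solve 1 (λ s → (:- s) :* con 1ℚ := :- (con 1ℚ :* s)) refl (sign (toℕ q))
sign-punchOut-anti {p = suc p} {zero}  p≢q q≢p = solve 1 (λ s → con 1ℚ :* s := :- ((:- s) :* con 1ℚ)) refl (sign (toℕ p))
sign-punchOut-anti {zero} {suc zero} {suc zero} p≢q q≢p = contradiction refl p≢q
sign-punchOut-anti {suc m} {suc p} {suc q} p≢q q≢p = begin
  (- a) * (- b) ≡⟨ solve 2 (λ a b → (:- a) :* (:- b) := a :* b) refl a b ⟩
  a * b         ≡⟨ sign-punchOut-anti (p≢q ∘ cong suc) (q≢p ∘ cong suc) ⟩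
  - (c * d)     ≡⟨ solve 2 (λ c d → :- (c :* d) := :- ((:- c) :* (:- d))) refl c d ⟩
  - ((- c) * (- d)) ∎
  where
  open ≡-Reasoning
  a b c d : ℚ
  a = sign (toℕ q)
  b = sign (toℕ (punchOut {i = q} {j = p} (q≢p ∘ cong suc)))
  c = sign (toℕ p)
  d = sign (toℕ (punchOut {i = p} {j = q} (p≢q ∘ cong suc)))

-- For R the rows 2, 3, … of a matrix, cofactor₂ R p q is the signed complementary minor of the
-- entries (0 , p) and (1 , q).
minorDet₂ : ∀ {m} → (Fin m → Fin (suc (suc m)) → ℚ) → Fin (suc (suc m)) → Fin (suc m) → ℚ
minorDet₂ R p l = detℚ (λ r c → R r (punchIn p (punchIn l c)))

cofactor₂ : ∀ {m} → (Fin m → Fin (suc (suc m)) → ℚ) → Fin (suc (suc m)) → Fin (suc (suc m)) → ℚ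
cofactor₂ R p q with p Finₚ.≟ q
... | yes _    = 0ℚ
... | no  p≢q = sign (toℕ p) * sign (toℕ (punchOut p≢q)) * minorDet₂ R p (punchOut p≢q)

cofactor₂-diag : ∀ {m} (R : Fin m → Fin (suc (suc m)) → ℚ) p → cofactor₂ R p p ≡ 0ℚ
cofactor₂-diag R p with p Finₚ.≟ p
... | yes _   = refl
... | no  p≢p = contradiction refl p≢p

cofactor₂-punchIn : ∀ {m} (R : Fin m → Fin (suc (suc m)) → ℚ) p l →
                    cofactor₂ R p (punchIn p l) ≡ sign (toℕ p) * sign (toℕ l) * minorDet₂ R p l
cofactor₂-punchIn R p l with p Finₚ.≟ punchIn p l
... | yes p≡pᵢ = contradiction (sym p≡pᵢ) (Finₚ.punchInᵢ≢i p l)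
... | no  p≢pᵢ = cong (λ l′ → sign (toℕ p) * sign (toℕ l′) * minorDet₂ R p l′)
                      (trans (Finₚ.punchOut-cong p refl) (Finₚ.punchOut-punchIn p))

cofactor₂-anti : ∀ {m} (R : Fin m → Fin (suc (suc m)) → ℚ) p q → cofactor₂ R q p ≡ - cofactor₂ R p q
cofactor₂-anti R p q with p Finₚ.≟ q | q Finₚ.≟ p
... | yes _    | yes _    = refl
... | yes refl | no  q≢p = contradiction refl q≢p
... | no  p≢q  | yes refl = contradiction refl p≢q
... | no  p≢q  | no  q≢p = begin
  sign (toℕ q) * sign (toℕ (punchOut q≢p)) * minorDet₂ R q (punchOut q≢p)
    ≡⟨ cong₂ _*_ (sign-punchOut-anti p≢q q≢p) same-minor ⟩
  - (sign (toℕ p) * sign (toℕ (punchOut p≢q))) * minorDet₂ R p (punchOut p≢q)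
    ≡⟨ ℚₚ.neg-distribˡ-* (sign (toℕ p) * sign (toℕ (punchOut p≢q))) (minorDet₂ R p (punchOut p≢q)) ⟨
  - (sign (toℕ p) * sign (toℕ (punchOut p≢q)) * minorDet₂ R p (punchOut p≢q)) ∎
  where
  open ≡-Reasoning
  same-minor : minorDet₂ R q (punchOut q≢p) ≡ minorDet₂ R p (punchOut p≢q)
  same-minor = det-cong (λ r c → cong (R r) (punchIn-punchOut-comm q≢p p≢q c))

cofactor-expand : ∀ {m} (A : Matrix (suc (suc m))) p →
                  cofactor A p ≡ sumR (λ q → A (suc zero) q * cofactor₂ (tail (tail A)) p q)
cofactor-expand {m} A p = sym (begin
  sumR (λ q → A (suc zero) q * K p q)
    ≡⟨ sumR-punchIn p (λ q → A (suc zero) q * K p q) ⟩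
  A (suc zero) p * K p p + sumR (λ l → A (suc zero) (punchIn p l) * K p (punchIn p l))
    ≡⟨ cong₂ _+_ (trans (cong (A (suc zero) p *_) (cofactor₂-diag R p)) (ℚₚ.*-zeroʳ (A (suc zero) p)))
                 (sumR-cong (λ l → trans (cong (A (suc zero) (punchIn p l) *_) (cofactor₂-punchIn R p l))
                                         (solve 4 (λ a s t d → a :* (s :* t :* d) := s :* (a :* (t :* d))) refl
                                                  (A (suc zero) (punchIn p l)) (sign (toℕ p)) (sign (toℕ l)) (minorDet₂ R p l)))) ⟩
  0ℚ + sumR (λ l → sign (toℕ p) * (minor A p zero l * cofactor (minor A p) l))
    ≡⟨ ℚₚ.+-identityˡ _ ⟩
  sumR (λ l → sign (toℕ p) * (minor A p zero l * cofactor (minor A p) l))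
    ≡⟨ sumR-*ˡ (sign (toℕ p)) (λ l → minor A p zero l * cofactor (minor A p) l) ⟩
  sign (toℕ p) * sumR (λ l → minor A p zero l * cofactor (minor A p) l)
    ≡⟨ cong (sign (toℕ p) *_) (det-expand (minor A p)) ⟨
  cofactor A p ∎)
  where
  open ≡-Reasoning
  R : Fin m → Fin (suc (suc m)) → ℚ
  R = tail (tail A)
  K : Fin (suc (suc m)) → Fin (suc (suc m)) → ℚ
  K = cofactor₂ R

det-expand₂ : ∀ {m} (A : Matrix (suc (suc m))) →
              detℚ A ≡ sumR (λ p → sumR (λ q → A zero p * (A (suc zero) q * cofactor₂ (tail (tail A)) p q)))
det-expand₂ A = trans (det-expand A) (sumR-cong λ p →
  trans (cong (A zero p *_) (cofactor-expand A p))
        (sym (sumR-*ˡ (A zero p) (λ q → A (suc zero) q * cofactor₂ (tail (tail A)) p q))))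

det-swap01 : ∀ {m} (A : Matrix (suc (suc m))) → detℚ (swapRows A zero (suc zero)) ≡ - detℚ A
det-swap01 {m} A = begin
  detℚ (swapRows A zero (suc zero))
    ≡⟨ det-expand₂ (swapRows A zero (suc zero)) ⟩
  sumR (λ p → sumR (λ q → A (suc zero) p * (A zero q * K p q)))
    ≡⟨ sumR-comm (λ p q → A (suc zero) p * (A zero q * K p q)) ⟩
  sumR (λ q → sumR (λ p → A (suc zero) p * (A zero q * K p q)))
    ≡⟨ sumR-cong (λ q → sumR-cong (λ p → trans (cong (λ k → A (suc zero) p * (A zero q * k)) (cofactor₂-anti _ q p))
         (solve 3 (λ b a k → b :* (a :* (:- k)) := :- (a :* (b :* k))) refl (A (suc zero) p) (A zero q) (K q p)))) ⟩
  sumR (λ q → sumR (λ p → - (A zero q * (A (suc zero) p * K q p))))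
    ≡⟨ trans (sumR-cong (λ q → sumR-neg (λ p → A zero q * (A (suc zero) p * K q p))))
             (sumR-neg (λ q → sumR (λ p → A zero q * (A (suc zero) p * K q p)))) ⟩
  - sumR (λ q → sumR (λ p → A zero q * (A (suc zero) p * K q p)))
    ≡⟨ cong -_ (det-expand₂ A) ⟨
  - detℚ A ∎
  where
  open ≡-Reasoning
  K : Fin (suc (suc m)) → Fin (suc (suc m)) → ℚ
  K = cofactor₂ (tail (tail A))

det-alternating : ∀ {n} (A : Matrix n) {p q} → p ≢ q → detℚ (swapRows A p q) ≡ - detℚ A
det-swap-suc    : ∀ {n} (A : Matrix (suc n)) {p q} → p ≢ q → detℚ (swapRows A (suc p) (suc q)) ≡ - detℚ A
det-swap-zero   : ∀ {n} (A : Matrix (suc n)) q → detℚ (swapRows A zero (suc q)) ≡ - detℚ A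

det-swap-suc A {p} {q} p≢q = begin
  detℚ (swapRows A (suc p) (suc q))
    ≡⟨ det-expand (swapRows A (suc p) (suc q)) ⟩
  sumR (λ j → A zero j * cofactor (swapRows A (suc p) (suc q)) j)
    ≡⟨ sumR-cong (λ j → trans (cong (λ d → A zero j * (sign (toℕ j) * d))
                                    (trans (det-cong (minor-swapRows A p q j)) (det-alternating (minor A j) p≢q)))
         (solve 3 (λ a s d → a :* (s :* (:- d)) := :- (a :* (s :* d))) refl (A zero j) (sign (toℕ j)) (detℚ (minor A j)))) ⟩
  sumR (λ j → - (A zero j * cofactor A j))
    ≡⟨ sumR-neg (λ j → A zero j * cofactor A j) ⟩
  - sumR (λ j → A zero j * cofactor A j)
    ≡⟨ cong -_ (det-expand A) ⟨
  - detℚ A ∎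
  where open ≡-Reasoning

-- The transposition (0 q) is the conjugate of (0 1) by (1 q).
det-swap-zero {suc m} A zero    = det-swap01 A
det-swap-zero {suc m} A (suc q) = begin
  detℚ (swapRows A zero q₂) ≡⟨ det-cong conjugate ⟩
  detℚ V                    ≡⟨ det-swap-suc U {zero} {suc q} (λ ()) ⟩
  - detℚ U                  ≡⟨ cong -_ (det-swap01 T) ⟩
  - (- detℚ T)              ≡⟨ cong (λ d → - (- d)) (det-swap-suc A {zero} {suc q} (λ ())) ⟩
  - (- (- detℚ A))          ≡⟨ solve 1 (λ d → :- (:- (:- d)) := :- d) refl (detℚ A) ⟩
  - detℚ A                  ∎
  where
  open ≡-Reasoning
  q₂ : Fin (suc (suc m))
  q₂ = suc (suc q)
  T U V : Matrix (suc (suc m))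
  T = swapRows A (suc zero) q₂
  U = swapRows T zero (suc zero)
  V = swapRows U (suc zero) q₂
  conjugate : swapRows A zero q₂ ≈ V
  conjugate zero          c = refl
  conjugate (suc zero)    c = sym (cong-app (Vecₚ.updateAt-updates q (tail (tail A))) c)
  conjugate (suc (suc i)) c = sym (cong-app (Vecₚ.updateAt-updateAt-local q (tail (tail A)) refl i) c)

det-alternating A {zero}  {zero}  p≢q = contradiction refl p≢q
det-alternating {suc n} A {zero}  {suc q} p≢q = det-swap-zero A q
det-alternating {suc n} A {suc p} {zero}  p≢q = trans (det-cong (rows≡⇒≈ (swapRows-comm A p≢q))) (det-swap-zero A p)
det-alternating {suc n} A {suc p} {suc q} p≢q = det-swap-suc A (p≢q ∘ cong suc)

record IsAlternatingMultilinear {n} (f : Matrix n → ℚ) : Set where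
  field
    ≈-cong      : ∀ {A B} → A ≈ B → f A ≡ f B
    rowLinear   : RowLinear f
    alternating : ∀ A {p q} → p ≢ q → f (swapRows A p q) ≡ - f A

det-isAlternatingMultilinear : ∀ {n} → IsAlternatingMultilinear (detℚ {n})
det-isAlternatingMultilinear = record
  { ≈-cong      = det-cong
  ; rowLinear   = det-rowLinear
  ; alternating = det-alternating
  }

module AlternatingMultilinear {n} {f : Matrix n → ℚ} (F : IsAlternatingMultilinear f) where
  open IsAlternatingMultilinear F public

  zero-row : ∀ A r → f (A [ r ]≔ const 0ℚ) ≡ 0ℚ
  zero-row A r = begin
    f (A [ r ]≔ const 0ℚ)                      ≡⟨ ≈-cong ([]≔-cong-≈ r ≈-refl (λ _ → refl)) ⟩
    f (A [ r ]≔ (λ c → 0ℚ + - 1ℚ * 0ℚ))      ≡⟨ rowLinear A r (const 0ℚ) (const 0ℚ) (- 1ℚ) ⟩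
    y + - 1ℚ * y                               ≡⟨ solve 1 (λ y → y :+ (:- con 1ℚ) :* y := con 0ℚ) refl y ⟩
    0ℚ                                         ∎
    where
    open ≡-Reasoning
    y : ℚ
    y = f (A [ r ]≔ const 0ℚ)

  linear-sum : ∀ A r {m} (w : Fin m → ℚ) (U : Fin m → Vector n) →
               f (A [ r ]≔ (λ c → sumR (λ k → w k * U k c))) ≡ sumR (λ k → w k * f (A [ r ]≔ U k))
  linear-sum A r {zero}  w U = zero-row A r
  linear-sum A r {suc m} w U = begin
    f (A [ r ]≔ (λ c → w zero * U zero c + rest c))
      ≡⟨ ≈-cong ([]≔-cong-≈ r ≈-refl (λ c → ℚₚ.+-comm (w zero * U zero c) (rest c))) ⟩
    f (A [ r ]≔ (λ c → rest c + w zero * U zero c))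
      ≡⟨ rowLinear A r rest (U zero) (w zero) ⟩
    f (A [ r ]≔ rest) + w zero * f (A [ r ]≔ U zero)
      ≡⟨ cong (_+ w zero * f (A [ r ]≔ U zero)) (linear-sum A r (w ∘ suc) (U ∘ suc)) ⟩
    sumR (λ k → w (suc k) * f (A [ r ]≔ U (suc k))) + w zero * f (A [ r ]≔ U zero)
      ≡⟨ ℚₚ.+-comm (sumR (λ k → w (suc k) * f (A [ r ]≔ U (suc k)))) _ ⟩
    w zero * f (A [ r ]≔ U zero) + sumR (λ k → w (suc k) * f (A [ r ]≔ U (suc k))) ∎
    where
    open ≡-Reasoning
    rest : Vector n
    rest c = sumR (λ k → w (suc k) * U (suc k) c)

  equal-rows : ∀ A {p q} → p ≢ q → A p ≗ A q → f A ≡ 0ℚ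
  equal-rows A p≢q Ap≗Aq = x≡-x⇒x≡0 (trans (≈-cong (≈-sym (swapRows-self A Ap≗Aq))) (alternating A p≢q))

  add-multiple : ∀ A {p q} → p ≢ q → ∀ x → f (A [ q ]≔ (λ c → A q c + x * A p c)) ≡ f A
  add-multiple A {p} {q} p≢q x = begin
    f (A [ q ]≔ (λ c → A q c + x * A p c))      ≡⟨ rowLinear A q (A q) (A p) x ⟩
    f (A [ q ]≔ A q) + x * f (A [ q ]≔ A p)     ≡⟨ cong₂ (λ a b → a + x * b) (≈-cong (rows≡⇒≈ (Vecₚ.updateAt-id-local q A refl)))
                                                          (equal-rows (A [ q ]≔ A p) p≢q
                                                             (cong-app (trans (Vecₚ.updateAt-minimal p q A p≢q)
                                                                              (sym (Vecₚ.updateAt-updates q A))))) ⟩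
    f A + x * 0ℚ                                ≡⟨ solve 2 (λ a x → a :+ x :* con 0ℚ := a) refl (f A) x ⟩
    f A                                         ∎
    where open ≡-Reasoning

punchIn-inject₁-self : ∀ {n} (j : Fin n) → punchIn (inject₁ j) j ≡ suc j
punchIn-inject₁-self zero    = refl
punchIn-inject₁-self (suc j) = cong suc (punchIn-inject₁-self j)

punchIn-suc-self : ∀ {n} (j : Fin n) → punchIn (suc j) j ≡ inject₁ j
punchIn-suc-self zero    = refl
punchIn-suc-self (suc j) = cong suc (punchIn-suc-self j)

punchIn-suc≡punchIn-inject₁ : ∀ {n} {j r : Fin n} → r ≢ j → punchIn (suc j) r ≡ punchIn (inject₁ j) r
punchIn-suc≡punchIn-inject₁ {j = zero}  {zero}  r≢j = contradiction refl r≢j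
punchIn-suc≡punchIn-inject₁ {j = zero}  {suc r} r≢j = refl
punchIn-suc≡punchIn-inject₁ {j = suc j} {zero}  r≢j = refl
punchIn-suc≡punchIn-inject₁ {j = suc j} {suc r} r≢j = cong suc (punchIn-suc≡punchIn-inject₁ (r≢j ∘ cong suc))

cycleMatrix : ∀ {n} → Fin (suc n) → Matrix (suc n)
cycleMatrix k = δ k ∷ (δ ∘ punchIn k)

cycleMatrix-suc : ∀ {n} (j : Fin n) → cycleMatrix (suc j) ≈ swapRows (cycleMatrix (inject₁ j)) zero (suc j)
cycleMatrix-suc j zero    c = cong (λ k → δ k c) (sym (punchIn-inject₁-self j))
cycleMatrix-suc j (suc r) c with r Finₚ.≟ j
... | yes refl = trans (cong (λ k → δ k c) (punchIn-suc-self r))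
                       (sym (cong-app (Vecₚ.updateAt-updates r (δ ∘ punchIn (inject₁ r))) c))
... | no  r≢j  = trans (cong (λ k → δ k c) (punchIn-suc≡punchIn-inject₁ r≢j))
                       (sym (cong-app (Vecₚ.updateAt-minimal r j (δ ∘ punchIn (inject₁ j)) r≢j) c))

border : ∀ {n} → Fin (suc n) → Matrix n → Vector n → Matrix (suc n)
border k M t = δ k ∷ λ r → insertAt (M r) k (t r)

module Border {n} {f : Matrix (suc n) → ℚ} (F : IsAlternatingMultilinear f) where
  open AlternatingMultilinear F

  -- Row 0 is δ k, so adding multiples of it to the other rows changes only column k.
  border-clear : ∀ k M t → f (border k M t) ≡ f (border k M (const 0ℚ))
  border-clear k M = reset-invariant⇒constant 0ℚ (f ∘ border k M) φ-cong reset
    where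
    φ-cong : ∀ {s t} → s ≗ t → f (border k M s) ≡ f (border k M t)
    φ-cong s≗t = ≈-cong λ { zero c → refl ; (suc r) c → cong (λ a → insertAt (M r) k a c) (s≗t r) }
    reset : ∀ t r → f (border k M (t [ r ]≔ 0ℚ)) ≡ f (border k M t)
    reset t r = sym (trans (≈-cong added) (add-multiple X {zero} {suc r} (λ ()) (t r)))
      where
      X : Matrix (suc n)
      X = border k M (t [ r ]≔ 0ℚ)
      added : border k M t ≈ (X [ suc r ]≔ (λ c → X (suc r) c + t r * X zero c))
      added zero    c = refl
      added (suc i) c with i Finₚ.≟ r
      ... | yes refl = begin
        insertAt (M i) k (t i) c                           ≡⟨ insertAt-split (M i) k (t i) c ⟩
        insertAt (M i) k 0ℚ c + t i * δ k c                ≡⟨ cong (λ a → insertAt (M i) k a c + t i * δ k c) (Vecₚ.updateAt-updates i t) ⟨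
        X (suc i) c + t i * δ k c                          ≡⟨ cong-app (Vecₚ.updateAt-updates (suc i) X) c ⟨
        (X [ suc i ]≔ (λ c → X (suc i) c + t i * X zero c)) (suc i) c ∎
        where open ≡-Reasoning
      ... | no  i≢r  = trans (cong (λ a → insertAt (M i) k a c) (sym (Vecₚ.updateAt-minimal i r t i≢r)))
                             (sym (cong-app (Vecₚ.updateAt-minimal (suc i) (suc r) X (i≢r ∘ Finₚ.suc-injective)) c))

  border-isAlternatingMultilinear : ∀ k → IsAlternatingMultilinear (λ M → f (border k M (const 0ℚ)))
  border-isAlternatingMultilinear k = record
    { ≈-cong      = λ M≈M′ → ≈-cong λ { zero c → refl ; (suc r) c → insertAt-cong k 0ℚ (M≈M′ r) c }
    ; rowLinear   = linear
    ; alternating = λ M p≢q → trans (≈-cong (rows≡⇒≈ (bordered-swap M _ _)))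
                                    (alternating (border k M (const 0ℚ)) (p≢q ∘ Finₚ.suc-injective))
    }
    where
    insert : Vector n → Vector (suc n)
    insert row = insertAt row k 0ℚ
    bordered-[]≔ : ∀ M r w → border k (M [ r ]≔ w) (const 0ℚ) ≗ (border k M (const 0ℚ) [ suc r ]≔ insert w)
    bordered-[]≔ M r w zero    = refl
    bordered-[]≔ M r w (suc i) = map-[]≔ insert M r w i
    bordered-swap : ∀ M p q → border k (swapRows M p q) (const 0ℚ) ≗ swapRows (border k M (const 0ℚ)) (suc p) (suc q)
    bordered-swap M p q zero    = refl
    bordered-swap M p q (suc i) = map-swapRows insert M p q i
    linear : RowLinear (λ M → f (border k M (const 0ℚ)))
    linear M r u v x = begin
      f (border k (M [ r ]≔ (λ c → u c + x * v c)) (const 0ℚ))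
        ≡⟨ ≈-cong (≈-trans (rows≡⇒≈ (bordered-[]≔ M r _)) ([]≔-cong-≈ (suc r) ≈-refl (insertAt-lincomb u v x k))) ⟩
      f (B [ suc r ]≔ (λ c → insert u c + x * insert v c))
        ≡⟨ rowLinear B (suc r) (insert u) (insert v) x ⟩
      f (B [ suc r ]≔ insert u) + x * f (B [ suc r ]≔ insert v)
        ≡⟨ cong₂ (λ a b → a + x * b) (≈-cong (rows≡⇒≈ (bordered-[]≔ M r u))) (≈-cong (rows≡⇒≈ (bordered-[]≔ M r v))) ⟨
      f (border k (M [ r ]≔ u) (const 0ℚ)) + x * f (border k (M [ r ]≔ v) (const 0ℚ)) ∎
      where
      open ≡-Reasoning
      B : Matrix (suc n)
      B = border k M (const 0ℚ)

  cycleMatrix-value : ∀ k → f (cycleMatrix k) ≡ sign (toℕ k) * f I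
  cycleMatrix-value = <-weakInduction (λ k → f (cycleMatrix k) ≡ sign (toℕ k) * f I) base step
    where
    base : f (cycleMatrix zero) ≡ 1ℚ * f I
    base = trans (≈-cong λ { zero c → refl ; (suc r) c → refl }) (sym (ℚₚ.*-identityˡ (f I)))
    step : ∀ j → f (cycleMatrix (inject₁ j)) ≡ sign (toℕ (inject₁ j)) * f I → f (cycleMatrix (suc j)) ≡ sign (suc (toℕ j)) * f I
    step j hyp = begin
      f (cycleMatrix (suc j))                           ≡⟨ ≈-cong (cycleMatrix-suc j) ⟩
      f (swapRows (cycleMatrix (inject₁ j)) zero (suc j)) ≡⟨ alternating (cycleMatrix (inject₁ j)) {zero} {suc j} (λ ()) ⟩
      - f (cycleMatrix (inject₁ j))                     ≡⟨ cong -_ (trans hyp (cong (λ m → sign m * f I) (Finₚ.toℕ-inject₁ j))) ⟩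
      - (sign (toℕ j) * f I)                            ≡⟨ ℚₚ.neg-distribˡ-* (sign (toℕ j)) (f I) ⟩
      sign (suc (toℕ j)) * f I                          ∎
      where open ≡-Reasoning

  border-I : ∀ k → f (border k I (const 0ℚ)) ≡ sign (toℕ k) * f I
  border-I k = trans (≈-cong λ { zero c → refl ; (suc r) c → insertAt-δ k r c }) (cycleMatrix-value k)

alternatingMultilinear⇒det* : ∀ {n} {f : Matrix n → ℚ} → IsAlternatingMultilinear f → ∀ A → f A ≡ detℚ A * f I
alternatingMultilinear⇒det* {zero}  F A = trans (IsAlternatingMultilinear.≈-cong F (λ ())) (sym (ℚₚ.*-identityˡ _))
alternatingMultilinear⇒det* {suc n} {f} F A = begin
  f A
    ≡⟨ ≈-cong row0-expanded ⟩
  f (A [ zero ]≔ (λ c → sumR (λ k → A zero k * δ k c)))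
    ≡⟨ linear-sum A zero (A zero) δ ⟩
  sumR (λ k → A zero k * f (A [ zero ]≔ δ k))
    ≡⟨ sumR-cong (λ k → trans (cong (A zero k *_) (row0-δ k)) (sym (ℚₚ.*-assoc (A zero k) (cofactor A k) (f I)))) ⟩
  sumR (λ k → A zero k * cofactor A k * f I)
    ≡⟨ sumR-*ʳ (f I) (λ k → A zero k * cofactor A k) ⟩
  sumR (λ k → A zero k * cofactor A k) * f I
    ≡⟨ cong (_* f I) (det-expand A) ⟨
  detℚ A * f I ∎
  where
  open ≡-Reasoning
  open Border F
  open AlternatingMultilinear F
  row0-expanded : A ≈ (A [ zero ]≔ (λ c → sumR (λ k → A zero k * δ k c)))
  row0-expanded zero    c = sym (sumR-δʳ c (A zero))
  row0-expanded (suc i) c = refl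
  row0-δ : ∀ k → f (A [ zero ]≔ δ k) ≡ cofactor A k * f I
  row0-δ k = begin
    f (A [ zero ]≔ δ k)
      ≡⟨ ≈-cong (λ { zero c → refl ; (suc r) c → sym (Vecₚ.insertAt-removeAt (A (suc r)) k c) }) ⟩
    f (border k (minor A k) (λ r → A (suc r) k))
      ≡⟨ border-clear k (minor A k) (λ r → A (suc r) k) ⟩
    f (border k (minor A k) (const 0ℚ))
      ≡⟨ alternatingMultilinear⇒det* (border-isAlternatingMultilinear k) (minor A k) ⟩
    detℚ (minor A k) * f (border k I (const 0ℚ))
      ≡⟨ cong (detℚ (minor A k) *_) (border-I k) ⟩
    detℚ (minor A k) * (sign (toℕ k) * f I)
      ≡⟨ solve 3 (λ d s y → d :* (s :* y) := s :* d :* y) refl (detℚ (minor A k)) (sign (toℕ k)) (f I) ⟩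
    cofactor A k * f I ∎

rowMul : ∀ {n} → Vector n → Matrix n → Vector n
rowMul v B c = sumR (λ k → v k * B k c)

det-·ʳ-isAlternatingMultilinear : ∀ {n} (B : Matrix n) → IsAlternatingMultilinear (λ A → detℚ (A · B))
det-·ʳ-isAlternatingMultilinear {n} B = record
  { ≈-cong      = λ A≈A′ → det-cong (·-cong A≈A′ ≈-refl)
  ; rowLinear   = linear
  ; alternating = λ A p≢q → trans (det-cong (rows≡⇒≈ (map-swapRows (λ row → rowMul row B) A _ _)))
                                  (det-alternating (A · B) p≢q)
  }
  where
  []≔-· : ∀ A r w → ((A [ r ]≔ w) · B) ≈ ((A · B) [ r ]≔ rowMul w B)
  []≔-· A r w = rows≡⇒≈ (map-[]≔ (λ row → rowMul row B) A r w)
  linear : RowLinear (λ A → detℚ (A · B))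
  linear A r u v x = begin
    detℚ ((A [ r ]≔ (λ c → u c + x * v c)) · B)
      ≡⟨ det-cong (≈-trans ([]≔-· A r _) ([]≔-cong-≈ r ≈-refl λ c →
           sumR-lincomb (λ k → u k * B k c) (λ k → v k * B k c) x
             (λ k → solve 4 (λ a x b y → (a :+ x :* b) :* y := a :* y :+ x :* (b :* y)) refl (u k) x (v k) (B k c)))) ⟩
    detℚ ((A · B) [ r ]≔ (λ c → rowMul u B c + x * rowMul v B c))
      ≡⟨ det-rowLinear (A · B) r (rowMul u B) (rowMul v B) x ⟩
    detℚ ((A · B) [ r ]≔ rowMul u B) + x * detℚ ((A · B) [ r ]≔ rowMul v B)
      ≡⟨ cong₂ (λ a b → a + x * b) (det-cong ([]≔-· A r u)) (det-cong ([]≔-· A r v)) ⟨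
    detℚ ((A [ r ]≔ u) · B) + x * detℚ ((A [ r ]≔ v) · B) ∎
    where open ≡-Reasoning

det-· : ∀ {n} (A B : Matrix n) → detℚ (A · B) ≡ detℚ A * detℚ B
det-· A B = trans (alternatingMultilinear⇒det* (det-·ʳ-isAlternatingMultilinear B) A)
                  (cong (detℚ A *_) (det-cong (·-identityˡ B)))

det-I : ∀ {n} → detℚ (I {n}) ≡ 1ℚ
det-I {zero}  = refl
det-I {suc n} = begin
  detℚ (I {suc n})                                 ≡⟨ det-expand (I {suc n}) ⟩
  sumR (λ j → δ zero j * cofactor (I {suc n}) j)   ≡⟨ sumR-δˡ zero (cofactor (I {suc n})) ⟩
  1ℚ * detℚ (I {n})                                ≡⟨ ℚₚ.*-identityˡ (detℚ (I {n})) ⟩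
  detℚ (I {n})                                     ≡⟨ det-I {n} ⟩
  1ℚ                                               ∎
  where open ≡-Reasoning

adjugate : ∀ {n} → Matrix n → Matrix n
adjugate A k j = detℚ (A [ j ]≔ δ k)

·-adjugate : ∀ {n} (A : Matrix n) i j → (A · adjugate A) i j ≡ detℚ A * δ i j
·-adjugate A i j = begin
  sumR (λ k → A i k * detℚ (A [ j ]≔ δ k))                ≡⟨ linear-sum A j (A i) δ ⟨
  detℚ (A [ j ]≔ (λ c → sumR (λ k → A i k * δ k c)))      ≡⟨ det-cong ([]≔-cong-≈ j ≈-refl (λ c → sumR-δʳ c (A i))) ⟩
  detℚ (A [ j ]≔ A i)                                     ≡⟨ row-i-at-j ⟩
  detℚ A * δ i j                                          ∎
  where
  open ≡-Reasoning
  open AlternatingMultilinear det-isAlternatingMultilinear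
  row-i-at-j : detℚ (A [ j ]≔ A i) ≡ detℚ A * δ i j
  row-i-at-j with i Finₚ.≟ j
  ... | yes refl = trans (det-cong (rows≡⇒≈ (Vecₚ.updateAt-id-local i A refl)))
                         (trans (sym (ℚₚ.*-identityʳ _)) (cong (detℚ A *_) (sym (δ-refl i))))
  ... | no  i≢j  = trans (equal-rows (A [ j ]≔ A i) i≢j
                            (cong-app (trans (Vecₚ.updateAt-minimal i j A i≢j) (sym (Vecₚ.updateAt-updates j A)))))
                         (sym (trans (cong (detℚ A *_) (δ-≢ i≢j)) (ℚₚ.*-zeroʳ (detℚ A))))

·≈I⇒det*det≡1 : ∀ {n} {A B : Matrix n} → (A · B) ≈ I → detℚ A * detℚ B ≡ 1ℚ
·≈I⇒det*det≡1 {n} {A} {B} AB≈I = trans (sym (det-· A B)) (trans (det-cong AB≈I) (det-I {n}))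

nonsingular⇒rightInverse : ∀ {n} {A : Matrix n} → Nonsingular A → Σ (Matrix n) (λ B → (A · B) ≈ I)
nonsingular⇒rightInverse {n} {A} detA≢0 = B , AB≈I
  where
  d⁻¹ : ℚ
  d⁻¹ = 1/_ (detℚ A) {{≢-nonZero detA≢0}}
  B : Matrix n
  B k j = d⁻¹ * adjugate A k j
  AB≈I : (A · B) ≈ I
  AB≈I i j = begin
    sumR (λ k → A i k * (d⁻¹ * adjugate A k j))
      ≡⟨ sumR-cong (λ k → solve 3 (λ a d b → a :* (d :* b) := d :* (a :* b)) refl (A i k) d⁻¹ (adjugate A k j)) ⟩
    sumR (λ k → d⁻¹ * (A i k * adjugate A k j))
      ≡⟨ sumR-*ˡ d⁻¹ (λ k → A i k * adjugate A k j) ⟩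
    d⁻¹ * (A · adjugate A) i j
      ≡⟨ cong (d⁻¹ *_) (·-adjugate A i j) ⟩
    d⁻¹ * (detℚ A * δ i j)
      ≡⟨ ℚₚ.*-assoc d⁻¹ (detℚ A) (δ i j) ⟨
    d⁻¹ * detℚ A * δ i j
      ≡⟨ cong (_* δ i j) (ℚₚ.*-inverseˡ (detℚ A) {{≢-nonZero detA≢0}}) ⟩
    1ℚ * δ i j
      ≡⟨ ℚₚ.*-identityˡ (δ i j) ⟩
    δ i j ∎
    where open ≡-Reasoning

rightInverse⇒leftInverse : ∀ {n} {A B : Matrix n} → (A · B) ≈ I → (B · A) ≈ I
rightInverse⇒leftInverse {n} {A} {B} AB≈I = begin
  B · A   ≈⟨ ·-congˡ B A≈C ⟩
  B · C   ≈⟨ BC≈I ⟩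
  I       ∎
  where
  open ≈-Reasoning
  B⁻¹ : Σ (Matrix n) (λ C → (B · C) ≈ I)
  B⁻¹ = nonsingular⇒rightInverse {A = B} (*≡1⇒≢0ʳ {detℚ A} (·≈I⇒det*det≡1 {n} {A} {B} AB≈I))
  C : Matrix n
  C = proj₁ B⁻¹
  BC≈I : (B · C) ≈ I
  BC≈I = proj₂ B⁻¹
  A≈C : A ≈ C
  A≈C = begin
    A             ≈⟨ ·-identityʳ A ⟨
    A · I         ≈⟨ ·-congˡ A BC≈I ⟨
    A · (B · C)   ≈⟨ ·-assoc A B C ⟨
    (A · B) · C   ≈⟨ ·-congʳ C AB≈I ⟩
    I · C         ≈⟨ ·-identityˡ C ⟩
    C             ∎

powVec-conjugate : ∀ {n} {A B P Q : Matrix n} {u v : Vector n} → (P · (A · Q)) ≈ B → (Q · P) ≈ I → u ≗ P ⊙ v →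
                   ∀ k → powVec B k u ≗ P ⊙ powVec A k v
powVec-conjugate PAQ≈B QP≈I u≗Pv zero = u≗Pv
powVec-conjugate {n} {A} {B} {P} {Q} {u} {v} PAQ≈B QP≈I u≗Pv (suc k) = begin
  B ⊙ powVec B k u            ≈⟨ ⊙-cong (≈-sym PAQ≈B) (powVec-conjugate {A = A} {B} {P} {Q} {u} {v} PAQ≈B QP≈I u≗Pv k) ⟩
  (P · (A · Q)) ⊙ (P ⊙ w)     ≈⟨ ⊙-assoc P (A · Q) (P ⊙ w) ⟩
  P ⊙ ((A · Q) ⊙ (P ⊙ w))     ≈⟨ ⊙-congˡ P (⊙-assoc A Q (P ⊙ w)) ⟩
  P ⊙ (A ⊙ (Q ⊙ (P ⊙ w)))     ≈⟨ ⊙-congˡ P (⊙-congˡ A (⊙-assoc Q P w)) ⟨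
  P ⊙ (A ⊙ ((Q · P) ⊙ w))     ≈⟨ ⊙-congˡ P (⊙-congˡ A (⊙-cong QP≈I (λ _ → refl))) ⟩
  P ⊙ (A ⊙ (I ⊙ w))           ≈⟨ ⊙-congˡ P (⊙-congˡ A (⊙-identityˡ w)) ⟩
  P ⊙ (A ⊙ w)                 ∎
  where
  open ≗-Reasoning
  w : Vector n
  w = powVec A k v

inverse-fixes : ∀ {n} {P Q : Matrix n} {v : Vector n} → (P · Q) ≈ I → Q ⊙ v ≗ v → P ⊙ v ≗ v
inverse-fixes {P = P} {Q} {v} PQ≈I Qv≗v = begin
  P ⊙ v          ≈⟨ ⊙-congˡ P Qv≗v ⟨
  P ⊙ (Q ⊙ v)    ≈⟨ ⊙-assoc P Q v ⟨
  (P · Q) ⊙ v    ≈⟨ ⊙-cong PQ≈I (λ _ → refl) ⟩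
  I ⊙ v          ≈⟨ ⊙-identityˡ v ⟩
  v              ∎
  where open ≗-Reasoning

lemma6 : (n : ℕ) (D C : OrientedGraph n) → Controllable D → SameGenSkewSpectrum D C
         → (Q : Matrix n) → Orthogonal Q → ((Q ᵀ) · (S D · Q)) ≈ S C → (∀ i → (Q ⊙ e) i ≡ e i)
         → Nonsingular (W C) × Σ (Matrix n) (λ M → IsInverse (W C) M × Q ≈ (W D · M))
-- The spectral hypothesis is only needed to produce Q, which here is given.
lemma6 n D C W[D]-nonsingular _ Q QᵀQ≈I QᵀSQ≈S Qe≗e =
  *≡1⇒≢0ˡ {y = detℚ M} (·≈I⇒det*det≡1 {A = W C} {M} W[C]M≈I) ,
  M , (W[C]M≈I , rightInverse⇒leftInverse {A = W C} {M} W[C]M≈I) , ≈-sym W[D]M≈Q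
  where
  open ≈-Reasoning
  W[D]⁻¹ : Matrix n
  W[D]⁻¹ = proj₁ (nonsingular⇒rightInverse {A = W D} W[D]-nonsingular)
  W[D]W[D]⁻¹≈I : (W D · W[D]⁻¹) ≈ I
  W[D]W[D]⁻¹≈I = proj₂ (nonsingular⇒rightInverse {A = W D} W[D]-nonsingular)
  M : Matrix n
  M = W[D]⁻¹ · Q
  W[C]≈QᵀW[D] : W C ≈ ((Q ᵀ) · W D)
  W[C]≈QᵀW[D] i k = powVec-conjugate {A = S D} {S C} {Q ᵀ} {Q} {e} {e} QᵀSQ≈S
                      (rightInverse⇒leftInverse {A = Q ᵀ} {Q} QᵀQ≈I)
                      (sym ∘ inverse-fixes {P = Q ᵀ} {Q} {e} QᵀQ≈I Qe≗e) (toℕ k) i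
  W[D]M≈Q : (W D · M) ≈ Q
  W[D]M≈Q = begin
    W D · (W[D]⁻¹ · Q)     ≈⟨ ·-assoc (W D) W[D]⁻¹ Q ⟨
    (W D · W[D]⁻¹) · Q     ≈⟨ ·-congʳ Q W[D]W[D]⁻¹≈I ⟩
    I · Q                  ≈⟨ ·-identityˡ Q ⟩
    Q                      ∎
  W[C]M≈I : (W C · M) ≈ I
  W[C]M≈I = begin
    W C · M                ≈⟨ ·-congʳ M W[C]≈QᵀW[D] ⟩
    ((Q ᵀ) · W D) · M      ≈⟨ ·-assoc (Q ᵀ) (W D) M ⟩
    (Q ᵀ) · (W D · M)      ≈⟨ ·-congˡ (Q ᵀ) W[D]M≈Q ⟩
    (Q ᵀ) · Q              ≈⟨ QᵀQ≈I ⟩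
    I                      ∎
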